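{- Let $n\ge2$ and $\lambda,\mu$ partitions. If $\mathrm{VST}^n(\lambda)$ has a highest weight element of weight $\mu$ (i.e. $V^\mu_\lambda\neq0$), then $\ell(\lambda)=\ell(\mu)$.
   Context: $\ell(\cdot)$ denotes the number of nonzero parts. A valued-set tableau of shape $\lambda$ with entries at most $n$ is a semistandard Young tableau of shape $\lambda$ (English convention) with entries in $\{1,\dots,n\}$, together with a division of each row into groups, each group a set of horizontally consecutive boxes of one row containing the same entry. Buoy/anchor: leftmost/rightmost box of a group. $\mathrm{VST}^n(\lambda)$ is the set of these; the weight is $(m_1,m_2,\dots)$, $m_j$ the number of groups with entry $j$. $V^\mu_\lambda$ is the number of highest weight elements of weight $\mu$ in $\mathrm{VST}^n(\lambda)$. Reading word: buoy entries only, columns left to right, each column bottom to top. For $i\in\{1,\dots,n-1\}$, write $+$ for each letter $i$, $-$ for each $i+1$, cancel pairs $-+$ successively. $e_iT$: $0$ if no uncanceled $-$; else let $\mathsf g$ be the group of the leftmost uncanceled $-$; if the entry immediately above the anchor of $\mathsf g$ is $i$, move the divider between $\mathsf g$ and the group immediately to its left one step up (remove it and insert a divider at the same horizontal position in the row above); otherwise change every $i+1$ of $\mathsf g$ to $i$. Highest weight: $e_iT=0$ for all $i$. -}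

module Defs where

open import Data.Nat using (ℕ; zero; suc; _+_; _∸_; _≤_; _<_; _≥_; _≡ᵇ_; _⊔_)
open import Data.Bool using (Bool; true; false; if_then_else_; _∧_)
open import Data.List using (List; []; _∷_; map; length; upTo; concatMap; foldr; [_])
open import Data.Nat.ListAction using (sum)
open import Data.List.Relation.Unary.All using (All)
open import Data.List.Relation.Unary.Linked using (Linked)
open import Data.Maybe using (Maybe; just; nothing)
open import Data.Product using (_×_; _,_; proj₁; ∃)
open import Data.Unit using (⊤)
open import Relation.Binary.PropositionalEquality using (_≡_; _≢_)

Partition : List ℕ → Set
Partition = Linked (λ a b → b ≤ a)

ℓ : List ℕ → ℕ
ℓ [] = 0
ℓ (zero ∷ xs) = ℓ xs
ℓ (suc _ ∷ xs) = suc (ℓ xs)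

-- j-th part (0-based), 0 beyond the end
part : List ℕ → ℕ → ℕ
part [] _ = 0
part (x ∷ xs) zero = x
part (x ∷ xs) (suc j) = part xs j

-- A box is (entry , isBuoy): isBuoy = true iff the
-- box is the leftmost box of its group (i.e. a divider sits on its left
-- or it is the first box of the row).  A tableau is a list of rows, top
-- row first (English convention).

Box : Set
Box = ℕ × Bool

Row : Set
Row = List Box

Tab : Set
Tab = List Row

entries : Row → List ℕ
entries = map proj₁

data ColStrict : List ℕ → List ℕ → Set where
  done : ∀ {us} → ColStrict us []
  step : ∀ {u us l ls} → u < l → ColStrict us ls → ColStrict (u ∷ us) (l ∷ ls)

-- a group consists of consecutive boxes with equal entries:
-- the first box of a row is a buoy, and a change of entry forces a buoy
GroupsRest : ℕ → Row → Set
GroupsRest a [] = ⊤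
GroupsRest a ((c , b) ∷ r) = (a ≢ c → b ≡ true) × GroupsRest c r

GroupsOK : Row → Set
GroupsOK [] = ⊤
GroupsOK ((a , b) ∷ r) = (b ≡ true) × GroupsRest a r

record VST (n : ℕ) (la : List ℕ) (T : Tab) : Set where
  field
    shape    : map length T ≡ la
    bounded  : All (λ r → All (λ x → 1 ≤ x × x ≤ n) (entries r)) T
    rowsWeak : All (λ r → Linked _≤_ (entries r)) T
    colsStr  : Linked ColStrict (map entries T)
    groups   : All GroupsOK T

-- Weight: m_j = number of groups (= buoys) with entry j.

countRow : ℕ → Row → ℕ
countRow j [] = 0
countRow j ((a , b) ∷ r) = (if b ∧ (a ≡ᵇ j) then 1 else 0) + countRow j r

wt : Tab → ℕ → ℕ
wt T j = sum (map (countRow j) T)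

HasWeight : Tab → List ℕ → Set
HasWeight T mu = ∀ j → wt T (suc j) ≡ part mu j

-- Reading word: buoy entries, columns left to right, each column bottom
-- to top.  Letters carry their position (row , column), 0-based.

nth : {A : Set} → List A → ℕ → Maybe A
nth [] _ = nothing
nth (x ∷ xs) zero = just x
nth (x ∷ xs) (suc k) = nth xs k

boxAt : Tab → ℕ → ℕ → Maybe Box
boxAt T r c with nth T r
... | nothing = nothing
... | just row = nth row c

width : Tab → ℕ
width = foldr (λ r w → length r ⊔ w) 0

Letter : Set
Letter = ℕ × ℕ × ℕ   -- entry , row , column

emit : Tab → ℕ → ℕ → List Letter
emit T r c with boxAt T r c
... | just (a , true) = [ (a , r , c) ]
... | _ = []

readingWord : Tab → List Letter
readingWord T =
  concatMap (λ c → concatMap (λ k → emit T (length T ∸ 1 ∸ k) c) (upTo (length T)))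
            (upTo (width T))

-- i-signature bracketing: + for i, - for i+1, cancel pairs -+ successively.
-- Returns the positions of the uncanceled -'s, most recent first.
unmatched : ℕ → List Letter → List (ℕ × ℕ) → List (ℕ × ℕ)
unmatched i [] st = st
unmatched i ((a , p) ∷ w) st =
  if a ≡ᵇ suc i then unmatched i w (p ∷ st)
  else if a ≡ᵇ i then unmatched i w (pop st)
  else unmatched i w st
  where
  pop : List (ℕ × ℕ) → List (ℕ × ℕ)
  pop [] = []
  pop (_ ∷ s) = s

lastElem : List (ℕ × ℕ) → Maybe (ℕ × ℕ)
lastElem [] = nothing
lastElem (x ∷ []) = just x
lastElem (x ∷ y ∷ s) = lastElem (y ∷ s)

-- The operator e_i (nothing represents 0).

modifyAt : {A : Set} → ℕ → (A → A) → List A → List A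
modifyAt _ f [] = []
modifyAt zero f (x ∷ xs) = f x ∷ xs
modifyAt (suc k) f (x ∷ xs) = x ∷ modifyAt k f xs

extra : Row → ℕ
extra [] = 0
extra ((_ , true) ∷ _) = 0
extra ((_ , false) ∷ r) = suc (extra r)

dropL : {A : Set} → ℕ → List A → List A
dropL zero xs = xs
dropL (suc k) [] = []
dropL (suc k) (_ ∷ xs) = dropL k xs

-- anchor column of the group whose buoy is at column c of the row
anchorCol : Row → ℕ → ℕ
anchorCol row c = c + extra (dropL (suc c) row)

atCol : ℕ → (Row → Row) → Row → Row
atCol zero f r = f r
atCol (suc c) f [] = []
atCol (suc c) f (x ∷ r) = x ∷ atCol c f r

lowerRest : ℕ → Row → Row
lowerRest i [] = []
lowerRest i ((a , false) ∷ r) = (i , false) ∷ lowerRest i r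
lowerRest i ((a , true) ∷ r) = (a , true) ∷ r

lowerGroup : ℕ → Row → Row
lowerGroup i [] = []
lowerGroup i ((a , b) ∷ r) = (i , b) ∷ lowerRest i r

setBuoy : Bool → Box → Box
setBuoy b (a , _) = (a , b)

aboveIs : ℕ → Maybe Box → Bool
aboveIs i (just (a , _)) = a ≡ᵇ i
aboveIs i nothing = false

rowOf : Tab → ℕ → Row
rowOf T r with nth T r
... | just row = row
... | nothing = []

entryAboveIs : ℕ → Tab → ℕ → ℕ → Bool
entryAboveIs i T zero c = false
entryAboveIs i T (suc r) c = aboveIs i (boxAt T r c)

e : ℕ → Tab → Maybe Tab
e i T with lastElem (unmatched i (readingWord T) [])
... | nothing = nothing
... | just (r , c) =
  if entryAboveIs i T r (anchorCol (rowOf T r) c)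
  then just (modifyAt (r ∸ 1) (modifyAt c (setBuoy true))
              (modifyAt r (modifyAt c (setBuoy false)) T))
  else just (modifyAt r (atCol c (lowerGroup i)) T)

HighestWeight : ℕ → Tab → Set
HighestWeight n T = ∀ i → 1 ≤ i → i < n → e i T ≡ nothing

{-# OPTIONS --safe #-}
module Submission where

-- In a highest weight tableau every buoy of row r carries the entry r+1.  Otherwise take a
-- buoy i+1 in a row r < i, with i minimal: by minimality the buoys i lie in row i−1, weakly
-- below it, so semistandardness forbids them in its column and to its right.  In the reading
-- word that letter i+1 is then followed by no letter i, stays unbracketed, and e_i T ≠ 0.
-- Hence the groups with entry j+1 are exactly the groups of row j, and μ_j ≠ 0 iff λ_j ≠ 0.

open import Defs
open import Data.Nat using (ℕ; zero; suc; _+_; _∸_; _≤_; _<_; _≡ᵇ_; z≤n; s≤s; z<s)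
open import Data.Nat.Properties
open import Data.Nat.ListAction using (sum)
open import Data.Bool using (Bool; true; false)
open import Data.Bool.Properties using (T-≡; ¬-not)
open import Data.List using (List; []; _∷_; map; length; upTo; applyUpTo; concatMap; _++_)
open import Data.List.Properties using (concatMap-++)
open import Data.List.Relation.Unary.All using (All; []; _∷_)
import Data.List.Relation.Unary.All.Properties as All
open import Data.List.Relation.Unary.Any using (here; there)
open import Data.List.Relation.Unary.Linked as Linked using (Linked; _∷_)
open import Data.List.Membership.Propositional using (_∈_; lose)
open import Data.List.Membership.Propositional.Properties using (∈-concatMap⁺; ∈-upTo⁺; ∈-applyUpTo⁺)
open import Data.Maybe using (just; nothing; maybe)
open import Data.Product using (_×_; _,_; proj₁; proj₂; ∃)
open import Data.Empty using (⊥-elim)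
open import Function using (_∘_; case_of_; Equivalence)
open import Relation.Nullary using (yes; no)
open import Relation.Binary.PropositionalEquality

just-injective : {A : Set} {x y : A} → just x ≡ just y → x ≡ y
just-injective refl = refl

nth-map : {A B : Set} (f : A → B) (xs : List A) (k : ℕ) {x : A} →
  nth xs k ≡ just x → nth (map f xs) k ≡ just (f x)
nth-map f (x ∷ xs) zero refl = refl
nth-map f (x ∷ xs) (suc k) h = nth-map f xs k h

nth-All : {A : Set} {P : A → Set} {xs : List A} (k : ℕ) {x : A} →
  All P xs → nth xs k ≡ just x → P x
nth-All zero (px ∷ _) refl = px
nth-All (suc k) (_ ∷ pxs) h = nth-All k pxs h

nth-< : {A : Set} (xs : List A) (k : ℕ) {x : A} → nth xs k ≡ just x → k < length xs
nth-< (x ∷ xs) zero h = z<s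
nth-< (x ∷ xs) (suc k) h = s≤s (nth-< xs k h)

nth-≤ : {A : Set} (xs : List A) {k k' : ℕ} {y : A} →
  k ≤ k' → nth xs k' ≡ just y → ∃ λ x → nth xs k ≡ just x
nth-≤ (x ∷ xs) z≤n h = x , refl
nth-≤ (x ∷ xs) (s≤s k≤k') h = nth-≤ xs k≤k' h

Linked-≤-nth : (xs : List ℕ) → Linked _≤_ xs → (k d : ℕ) {x y : ℕ} →
  nth xs k ≡ just x → nth xs (k + d) ≡ just y → x ≤ y
Linked-≤-nth (x ∷ xs) l zero zero refl refl = ≤-refl
Linked-≤-nth (x ∷ x' ∷ xs) (x≤x' ∷ l) zero (suc d) refl h =
  ≤-trans x≤x' (Linked-≤-nth (x' ∷ xs) l zero d refl h)
Linked-≤-nth (x ∷ xs) l (suc k) d h h' = Linked-≤-nth xs (Linked.tail l) k d h h'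

part-map : {A : Set} (f : A → ℕ) (xs : List A) (j : ℕ) →
  part (map f xs) j ≡ maybe f 0 (nth xs j)
part-map f [] j = refl
part-map f (x ∷ xs) zero = refl
part-map f (x ∷ xs) (suc j) = part-map f xs j

sum-map-≡0 : {A : Set} (f : A → ℕ) (xs : List A) →
  (∀ r {x} → nth xs r ≡ just x → f x ≡ 0) → sum (map f xs) ≡ 0
sum-map-≡0 f [] f≡0 = refl
sum-map-≡0 f (x ∷ xs) f≡0 =
  cong₂ _+_ (f≡0 0 refl) (sum-map-≡0 f xs (f≡0 ∘ suc))

sum-map-nth : {A : Set} (f : A → ℕ) (xs : List A) (j : ℕ) →
  (∀ r {x} → r ≢ j → nth xs r ≡ just x → f x ≡ 0) →
  sum (map f xs) ≡ maybe f 0 (nth xs j)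
sum-map-nth f [] j f≡0 = refl
sum-map-nth f (x ∷ xs) zero f≡0 =
  trans (cong (f x +_) (sum-map-≡0 f xs (λ r → f≡0 (suc r) (λ ())))) (+-identityʳ (f x))
sum-map-nth f (x ∷ xs) (suc j) f≡0 =
  cong₂ _+_ (f≡0 0 (λ ()) refl) (sum-map-nth f xs j (λ r r≢j → f≡0 (suc r) (r≢j ∘ suc-injective)))

ColStrict-nth : ∀ {us ls} → ColStrict us ls → (c : ℕ) {b : ℕ} →
  nth ls c ≡ just b → ∃ λ a → nth us c ≡ just a × a < b
ColStrict-nth (step {u = u} u<l _) zero refl = u , refl , u<l
ColStrict-nth (step _ cs) (suc c) h = ColStrict-nth cs c h

Linked-ColStrict-nth : (rows : List (List ℕ)) → Linked ColStrict rows → (r d c : ℕ) {us ls : List ℕ} {b : ℕ} →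
  nth rows r ≡ just us → nth rows (r + d) ≡ just ls → nth ls c ≡ just b →
  ∃ λ a → nth us c ≡ just a × a + d ≤ b
Linked-ColStrict-nth (_ ∷ _) _ zero zero c {b = b} refl refl h = b , h , ≤-reflexive (+-identityʳ b)
Linked-ColStrict-nth (_ ∷ ls ∷ rows) (cs ∷ l) zero (suc d) c refl h h'
  with Linked-ColStrict-nth (ls ∷ rows) l zero d c refl h h'
... | a' , ha' , a'+d≤b with ColStrict-nth cs c ha'
... | a , ha , a<a' = a , ha , ≤-trans (≤-reflexive (+-suc a d)) (≤-trans (+-monoˡ-≤ d a<a') a'+d≤b)
Linked-ColStrict-nth (_ ∷ rows) l (suc r) d c h h' h'' =
  Linked-ColStrict-nth rows (Linked.tail l) r d c h h' h''

≡ᵇ-refl : ∀ m → (m ≡ᵇ m) ≡ true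
≡ᵇ-refl m = Equivalence.to T-≡ (≡⇒≡ᵇ m m refl)

≢⇒≡ᵇ-false : ∀ m n → m ≢ n → (m ≡ᵇ n) ≡ false
≢⇒≡ᵇ-false m n m≢n = ¬-not (m≢n ∘ ≡ᵇ⇒≡ m n ∘ Equivalence.from T-≡)

NotLetter : ℕ → Letter → Set
NotLetter i l = proj₁ l ≢ i

unmatched-++ : ∀ i u v st → unmatched i (u ++ v) st ≡ unmatched i v (unmatched i u st)
unmatched-++ i [] v st = refl
unmatched-++ i ((a , p) ∷ u) v st with a ≡ᵇ suc i
... | true = unmatched-++ i u v (p ∷ st)
... | false with a ≡ᵇ i
...   | true = unmatched-++ i u v _
...   | false = unmatched-++ i u v st

unmatched-∷≢[] : ∀ i v p st → All (NotLetter i) v → unmatched i v (p ∷ st) ≢ []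
unmatched-∷≢[] i [] p st _ ()
unmatched-∷≢[] i ((a , q) ∷ v) p st (a≢i ∷ v≢i) with a ≡ᵇ suc i
... | true = unmatched-∷≢[] i v q (p ∷ st) v≢i
... | false rewrite ≢⇒≡ᵇ-false a i a≢i = unmatched-∷≢[] i v p st v≢i

unmatched-≢[] : ∀ i u v st {p} → (suc i , p) ∈ v → All (NotLetter i) v → unmatched i (u ++ v) st ≢ []
unmatched-≢[] i u v st p∈v v≢i rewrite unmatched-++ i u v st = go v _ p∈v v≢i
  where
  go : ∀ v st {p} → (suc i , p) ∈ v → All (NotLetter i) v → unmatched i v st ≢ []
  go ((_ , q) ∷ v) st (here refl) (_ ∷ v≢i) rewrite ≡ᵇ-refl i = unmatched-∷≢[] i v q st v≢i
  go ((a , q) ∷ v) st (there p∈v) (a≢i ∷ v≢i) with a ≡ᵇ suc i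
  ... | true = unmatched-∷≢[] i v q st v≢i
  ... | false rewrite ≢⇒≡ᵇ-false a i a≢i = go v st p∈v v≢i

lastElem-nothing : ∀ s → lastElem s ≡ nothing → s ≡ []
lastElem-nothing [] _ = refl
lastElem-nothing (x ∷ []) ()
lastElem-nothing (x ∷ y ∷ s) h = case lastElem-nothing (y ∷ s) h of λ ()

e-≢nothing : ∀ i T → unmatched i (readingWord T) [] ≢ [] → e i T ≢ nothing
e-≢nothing i T ne eq with lastElem (unmatched i (readingWord T) []) in eqLast
... | nothing = ne (lastElem-nothing _ eqLast)
e-≢nothing i T ne eq | just (r , c) with entryAboveIs i T r (anchorCol (rowOf T r) c)
e-≢nothing i T ne () | just (r , c) | true
e-≢nothing i T ne () | just (r , c) | false

boxAt⁻ : ∀ T r c {b} → boxAt T r c ≡ just b → ∃ λ row → nth T r ≡ just row × nth row c ≡ just b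
boxAt⁻ T r c h with nth T r
... | just row = row , refl , h

boxAt⁺ : ∀ T r c {row b} → nth T r ≡ just row → nth row c ≡ just b → boxAt T r c ≡ just b
boxAt⁺ T r c h h' rewrite h = h'

width-≥ : ∀ T r {row} → nth T r ≡ just row → length row ≤ width T
width-≥ (row ∷ T) zero refl = m≤m⊔n (length row) (width T)
width-≥ (row ∷ T) (suc r) h = ≤-trans (width-≥ T r h) (m≤n⊔m _ (width T))

boxAt-<width : ∀ T r c {b} → boxAt T r c ≡ just b → c < width T
boxAt-<width T r c h with boxAt⁻ T r c h
... | row , hrow , hc = ≤-trans (nth-< row c hc) (width-≥ T r hrow)

column : Tab → ℕ → List Letter
column T c = concatMap (λ k → emit T (length T ∸ 1 ∸ k) c) (upTo (length T))

applyUpTo-+ : {A : Set} (f : ℕ → A) (c d : ℕ) →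
  applyUpTo f (c + d) ≡ applyUpTo f c ++ applyUpTo (f ∘ (c +_)) d
applyUpTo-+ f zero d = refl
applyUpTo-+ f (suc c) d = cong (f 0 ∷_) (applyUpTo-+ (f ∘ suc) c d)

readingWord-split : ∀ T c → c ≤ width T →
  readingWord T ≡ concatMap (column T) (upTo c) ++ concatMap (column T) (applyUpTo (c +_) (width T ∸ c))
readingWord-split T c c≤w = begin
  concatMap (column T) (upTo (width T))
    ≡⟨ cong (concatMap (column T) ∘ upTo) (sym (m+[n∸m]≡n c≤w)) ⟩
  concatMap (column T) (upTo (c + (width T ∸ c)))
    ≡⟨ cong (concatMap (column T)) (applyUpTo-+ (λ k → k) c (width T ∸ c)) ⟩
  concatMap (column T) (upTo c ++ applyUpTo (c +_) (width T ∸ c))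
    ≡⟨ concatMap-++ (column T) (upTo c) _ ⟩
  concatMap (column T) (upTo c) ++ concatMap (column T) (applyUpTo (c +_) (width T ∸ c)) ∎
  where open ≡-Reasoning

buoy∈column : ∀ T r c {a} → boxAt T r c ≡ just (a , true) → (a , r , c) ∈ column T c
buoy∈column T r c {a} h = go (length T) (nth-< T r (proj₁ (proj₂ (boxAt⁻ T r c h))))
  where
  emit-buoy : (a , r , c) ∈ emit T r c
  emit-buoy rewrite h = here refl
  go : ∀ L → r < L → (a , r , c) ∈ concatMap (λ k → emit T (L ∸ 1 ∸ k) c) (upTo L)
  go (suc m) (s≤s r≤m) = ∈-concatMap⁺ _ (lose (∈-upTo⁺ (s≤s (m∸n≤m m r))) emit-r)
    where
    emit-r : (a , r , c) ∈ emit T (m ∸ (m ∸ r)) c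
    emit-r rewrite m∸[m∸n]≡n r≤m = emit-buoy

All-column : ∀ {P : Letter → Set} T c → (∀ r a → boxAt T r c ≡ just (a , true) → P (a , r , c)) →
  All P (column T c)
All-column {P} T c buoy⇒P = All.concat⁺ (All.map⁺ (All.applyUpTo⁺₂ _ (length T) (λ k → All-emit _)))
  where
  All-emit : ∀ r → All P (emit T r c)
  All-emit r with boxAt T r c in eq
  ... | nothing = []
  ... | just (a , false) = []
  ... | just (a , true) = buoy⇒P r a eq ∷ []

unmatched-readingWord-≢[] : ∀ i T r c → boxAt T r c ≡ just (suc i , true) →
  (∀ r' c' → c ≤ c' → boxAt T r' c' ≢ just (i , true)) →
  unmatched i (readingWord T) [] ≢ []
unmatched-readingWord-≢[] i T r c buoy no-i
  rewrite readingWord-split T c (<⇒≤ (boxAt-<width T r c buoy)) =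
  unmatched-≢[] i (concatMap (column T) (upTo c)) _ [] i+1∈ no-i-after
  where
  c<w : c < width T
  c<w = boxAt-<width T r c buoy
  c∈ : c ∈ applyUpTo (c +_) (width T ∸ c)
  c∈ = subst (_∈ applyUpTo (c +_) (width T ∸ c)) (+-identityʳ c) (∈-applyUpTo⁺ (c +_) (m<n⇒0<n∸m c<w))
  i+1∈ : (suc i , r , c) ∈ concatMap (column T) (applyUpTo (c +_) (width T ∸ c))
  i+1∈ = ∈-concatMap⁺ (column T) (lose c∈ (buoy∈column T r c buoy))
  no-i-after : All (NotLetter i) (concatMap (column T) (applyUpTo (c +_) (width T ∸ c)))
  no-i-after = All.concat⁺ (All.map⁺ {f = column T} (All.applyUpTo⁺₂ (c +_) (width T ∸ c) λ k →
    All-column T (c + k) λ r' a buoy' a≡i →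
      no-i r' (c + k) (m≤m+n c k) (subst (λ x → _ ≡ just (x , true)) a≡i buoy')))

BuoysMatchRows : Tab → Set
BuoysMatchRows T = ∀ v r c → boxAt T r c ≡ just (v , true) → v ≡ suc r

module _ {n : ℕ} {la : List ℕ} {T : Tab} (V : VST n la T) where
  open VST V

  private
    entry-at : ∀ {r c a b} → boxAt T r c ≡ just (a , b) →
      ∃ λ row → nth T r ≡ just row × nth (map entries T) r ≡ just (entries row) × nth (entries row) c ≡ just a
    entry-at {r} {c} h with boxAt⁻ T r c h
    ... | row , hT , hc = row , hT , nth-map entries T r hT , nth-map proj₁ row c hc

    entry-bounds : ∀ {r c row a} → nth T r ≡ just row → nth (entries row) c ≡ just a → 1 ≤ a × a ≤ n
    entry-bounds {r} {c} hT hc = nth-All c (nth-All r bounded hT) hc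

  entry≤n : ∀ {r c a b} → boxAt T r c ≡ just (a , b) → a ≤ n
  entry≤n h with entry-at h
  ... | _ , hT , _ , hc = proj₂ (entry-bounds hT hc)

  row<entry : ∀ {r c a b} → boxAt T r c ≡ just (a , b) → r < a
  row<entry {r} {c} h with entry-at h
  ... | _ , hT , hE , hc with nth-≤ T z≤n hT
  ... | top , htop with Linked-ColStrict-nth (map entries T) colsStr 0 r c (nth-map entries T 0 htop) hE hc
  ... | a₀ , ha₀ , a₀+r≤a = ≤-trans (+-monoˡ-≤ r (proj₁ (entry-bounds htop ha₀))) a₀+r≤a

  entry-mono : ∀ {r r' c c' a a' b b'} → r ≤ r' → c ≤ c' →
    boxAt T r c ≡ just (a , b) → boxAt T r' c' ≡ just (a' , b') → a ≤ a'
  entry-mono {r} {c = c} {a = a} {a'} r≤r' c≤c' h h'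
    with m≤n⇒∃[o]m+o≡n r≤r' | m≤n⇒∃[o]m+o≡n c≤c' | entry-at h | entry-at h'
  ... | d , refl | k , refl | _ , _ , hE , hc | row' , hT' , hE' , hc'
    with nth-≤ (entries row') c≤c' hc'
  ... | x , hx with Linked-ColStrict-nth (map entries T) colsStr r d c hE hE' hx
  ... | a₀ , ha₀ , a₀+d≤x = begin
    a       ≡⟨ just-injective (trans (sym hc) ha₀) ⟩
    a₀      ≤⟨ m≤m+n a₀ d ⟩
    a₀ + d  ≤⟨ a₀+d≤x ⟩
    x       ≤⟨ Linked-≤-nth (entries row') (nth-All (r + d) rowsWeak hT') c k hx hc' ⟩
    a'      ∎
    where open ≤-Reasoning

  highestWeight⇒buoysMatchRows : HighestWeight n T → BuoysMatchRows T
  highestWeight⇒buoysMatchRows hw zero r c h = ⊥-elim (case row<entry h of λ ())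
  highestWeight⇒buoysMatchRows hw (suc i) r c h with r ≟ i
  ... | yes refl = refl
  ... | no r≢i = ⊥-elim (e-≢nothing i T (unmatched-readingWord-≢[] i T r c h no-i-right) (hw i 1≤i i<n))
    where
    r<i : r < i
    r<i = ≤∧≢⇒< (≤-pred (row<entry h)) r≢i
    1≤i : 1 ≤ i
    1≤i = ≤-trans (s≤s z≤n) r<i
    i<n : i < n
    i<n = entry≤n h
    no-i-right : ∀ r' c' → c ≤ c' → boxAt T r' c' ≢ just (i , true)
    no-i-right r' c' c≤c' h' with highestWeight⇒buoysMatchRows hw i r' c' h'
    ... | refl = 1+n≰n (entry-mono (≤-pred r<i) c≤c' h h')

isZero : ℕ → Bool
isZero zero = true
isZero (suc _) = false

ℓ-cong : ∀ xs ys → (∀ j → isZero (part xs j) ≡ isZero (part ys j)) → ℓ xs ≡ ℓ ys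
ℓ-cong [] [] _ = refl
ℓ-cong [] (zero ∷ ys) H = ℓ-cong [] ys (H ∘ suc)
ℓ-cong [] (suc _ ∷ _) H = case H 0 of λ ()
ℓ-cong (zero ∷ xs) [] H = ℓ-cong xs [] (H ∘ suc)
ℓ-cong (suc _ ∷ _) [] H = case H 0 of λ ()
ℓ-cong (zero ∷ xs) (zero ∷ ys) H = ℓ-cong xs ys (H ∘ suc)
ℓ-cong (zero ∷ _) (suc _ ∷ _) H = case H 0 of λ ()
ℓ-cong (suc _ ∷ _) (zero ∷ _) H = case H 0 of λ ()
ℓ-cong (suc _ ∷ xs) (suc _ ∷ ys) H = cong suc (ℓ-cong xs ys (H ∘ suc))

BuoysAre : ℕ → Row → Set
BuoysAre a row = ∀ c v → nth row c ≡ just (v , true) → v ≡ a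

countRow-≢ : ∀ a m row → BuoysAre a row → a ≢ m → countRow m row ≡ 0
countRow-≢ a m [] _ _ = refl
countRow-≢ a m ((v , false) ∷ row) buoys a≢m = countRow-≢ a m row (buoys ∘ suc) a≢m
countRow-≢ a m ((v , true) ∷ row) buoys a≢m
  rewrite buoys 0 v refl | ≢⇒≡ᵇ-false a m a≢m = countRow-≢ a m row (buoys ∘ suc) a≢m

countRow-isZero : ∀ a row → BuoysAre a row → GroupsOK row → isZero (countRow a row) ≡ isZero (length row)
countRow-isZero a [] _ _ = refl
countRow-isZero a ((v , true) ∷ row) buoys (refl , _) rewrite buoys 0 v refl | ≡ᵇ-refl a = refl

wt-isZero : ∀ T → All GroupsOK T → BuoysMatchRows T →
  ∀ j → isZero (wt T (suc j)) ≡ isZero (part (map length T) j)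
wt-isZero T groups buoy j = begin
  isZero (wt T (suc j))                          ≡⟨ cong isZero (sum-map-nth (countRow (suc j)) T j other-row) ⟩
  isZero (maybe (countRow (suc j)) 0 (nth T j))  ≡⟨ own-row ⟩
  isZero (maybe length 0 (nth T j))              ≡⟨ cong isZero (part-map length T j) ⟨
  isZero (part (map length T) j)                 ∎
  where
  open ≡-Reasoning
  buoys-of-row : ∀ r {row} → nth T r ≡ just row → BuoysAre (suc r) row
  buoys-of-row r hT c v hc = buoy v r c (boxAt⁺ T r c hT hc)
  other-row : ∀ r {row} → r ≢ j → nth T r ≡ just row → countRow (suc j) row ≡ 0
  other-row r {row} r≢j hT = countRow-≢ (suc r) (suc j) row (buoys-of-row r hT) (r≢j ∘ suc-injective)
  own-row : isZero (maybe (countRow (suc j)) 0 (nth T j)) ≡ isZero (maybe length 0 (nth T j))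
  own-row with nth T j in hT
  ... | nothing = refl
  ... | just row = countRow-isZero (suc j) row (buoys-of-row j hT) (nth-All j groups hT)

corollary5p8 : (n : ℕ) → 2 ≤ n → (la mu : List ℕ) → Partition la → Partition mu →
    (∃ λ T → VST n la T × HighestWeight n T × HasWeight T mu) →
    ℓ la ≡ ℓ mu
corollary5p8 n _ la mu _ _ (T , V , hw , weight) = ℓ-cong la mu λ j → begin
  isZero (part la j)              ≡⟨ cong (λ shape → isZero (part shape j)) (VST.shape V) ⟨
  isZero (part (map length T) j)  ≡⟨ wt-isZero T (VST.groups V) (highestWeight⇒buoysMatchRows V hw) j ⟨
  isZero (wt T (suc j))           ≡⟨ cong isZero (weight j) ⟩
  isZero (part mu j)              ∎
  where open ≡-Reasoning
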